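{- If $\mathcal H$ is an FLP-tight simple program and $X$ is a non-empty set of atoms, then there exists a non-empty subset $K\subseteq X$ such that, in the subgraph of the dependency graph of $\mathcal H$ induced by $X$, (i) there are no edges from atoms in $K$ to atoms in $X\setminus K$, and (ii) no atom in $K$ has outgoing FLP-critical edges.
   Context: Extended literals over a set of atoms: $p,\neg p,\neg\neg p$ (with $\neg F=F\to\bot$). A simple disjunction is a (possibly infinite) disjunction of extended literals; a simple implication is $\mathcal A^\land\to\mathcal L^\lor$ with $\mathcal A$ a set of atoms and $\mathcal L^\lor$ a simple disjunction; a simple formula is a conjunction of simple implications; a simple rule is $G\to H$ with $G$ a simple formula and $H$ a disjunction of atoms; a simple program is a set of simple rules. An atom $q$ occurs positively in $G$ if $q$ or $\neg\neg q$ belongs to $\mathcal L$ for some conjunctive term $\mathcal A^\land\to\mathcal L^\lor$ of $G$. The dependency graph of $\mathcal H$ has the atoms occurring in $\mathcal H$ as vertices and an edge $p\to q$ if for some $G\to H\in\mathcal H$, $p$ is a disjunctive term of $H$ and $q$ occurs positively in $G$; the edge is FLP-critical if for some $G\to H\in\mathcal H$, $p$ is a disjunctive term of $H$ and $\neg\neg q\in\mathcal L$ for some conjunctive term $\mathcal A^\land\to\mathcal L^\lor$ of $G$. $\mathcal H$ is FLP-tight if its dependency graph has no path containing infinitely many FLP-critical edges. -}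

module Defs where

open import Data.Nat using (ℕ; suc; _≥_)
open import Data.Product using (Σ; ∃; _×_; _,_)
open import Data.Sum using (_⊎_)
open import Data.Empty using (⊥)
open import Relation.Nullary using (¬_)

-- Sets of atoms / literals are predicates; "sets" of structured objects
-- (conjunctive terms, rules) are indexed families over an arbitrary index type,
-- so that infinite conjunctions/disjunctions/programs are allowed.

module _ (Atom : Set) where

  data ExtLit : Set where
    pos    : Atom → ExtLit
    neg    : Atom → ExtLit
    negneg : Atom → ExtLit

  SimpleDisj : Set₁
  SimpleDisj = ExtLit → Set

  -- simple implication  𝒜^∧ → ℒ^∨
  record SimpleImpl : Set₁ where
    field
      ants : Atom → Set
      lits : SimpleDisj

  -- simple formula: a conjunction of simple implications
  record SimpleFormula : Set₁ where
    field
      Term : Set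
      term : Term → SimpleImpl

  -- simple rule  G → H, H a disjunction of atoms
  record SimpleRule : Set₁ where
    field
      body : SimpleFormula
      head : Atom → Set

  record SimpleProgram : Set₁ where
    field
      Rule : Set
      rule : Rule → SimpleRule

  open SimpleImpl
  open SimpleFormula
  open SimpleRule
  open SimpleProgram

  OccursPos : Atom → SimpleFormula → Set
  OccursPos q G = Σ (Term G) λ t → lits (term G t) (pos q) ⊎ lits (term G t) (negneg q)

  Edge : SimpleProgram → Atom → Atom → Set
  Edge 𝓗 p q = Σ (Rule 𝓗) λ r → head (rule 𝓗 r) p × OccursPos q (body (rule 𝓗 r))

  Critical : SimpleProgram → Atom → Atom → Set
  Critical 𝓗 p q = Σ (Rule 𝓗) λ r → head (rule 𝓗 r) p ×
    Σ (Term (body (rule 𝓗 r))) λ t → lits (term (body (rule 𝓗 r)) t) (negneg q)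

  FLPTight : SimpleProgram → Set
  FLPTight 𝓗 = ¬ (Σ (ℕ → Atom) λ f →
                    ((n : ℕ) → Edge 𝓗 (f n) (f (suc n))) ×
                    ((n : ℕ) → Σ ℕ λ m → m ≥ n × Critical 𝓗 (f m) (f (suc m))))

-- Call a ∈ X safe if no FLP-critical edge into X leaves an atom reachable from a
-- inside X.  For a safe a, the set K of atoms reachable from a inside X works.
-- If no atom of X were safe, then (classically) from every atom of X one could
-- walk inside X to a critical edge into X, and chaining these walks gives an
-- infinite path with infinitely many critical edges, contradicting FLP-tightness.
module Submission where

open import Defs
open import Level using (0ℓ)
open import Axiom.ExcludedMiddle using (ExcludedMiddle)
open import Axiom.DoubleNegationElimination using (DoubleNegationElimination; em⇒dne)
open import Data.Product using (Σ; ∃; ∃₂; _×_; _,_; proj₁; proj₂; map₂)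
open import Data.Sum using (inj₂)
open import Data.Nat using (ℕ; suc; _≥_; z≤n; s≤s)
open import Data.Nat.GeneralisedArithmetic using (iterate)
open import Data.Empty using (⊥-elim)
open import Function using (_∘_)
open import Relation.Binary using (Rel; _⇒_)
open import Relation.Binary.Construct.Closure.ReflexiveTransitive using (Star; ε; _◅_; _◅◅_)
open import Relation.Nullary using (¬_; yes; no)

InfinitelyOften : (ℕ → Set) → Set
InfinitelyOften Q = ∀ n → ∃ λ m → m ≥ n × Q m

-- The walks are chained by a state machine whose state is the current vertex
-- together with the rest of the walk still to be taken.
module _ {A : Set} {R C : Rel A 0ℓ} (C⇒R : C ⇒ R) (P : A → Set)
         (progress : ∀ {a} → P a → ∃₂ λ b c → Star R a b × C b c × P c) where

  private
    State : Set
    State = ∃ λ a → ∃₂ λ b c → Star R a b × C b c × P c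

    step : State → State
    step (a , b , c , ε , cr , pc) = c , progress pc
    step (a , b , c , r ◅ rs , cr , pc) = _ , b , c , rs , cr , pc

    R-step : ∀ s → R (proj₁ s) (proj₁ (step s))
    R-step (a , b , c , ε , cr , pc) = C⇒R cr
    R-step (a , b , c , r ◅ rs , cr , pc) = r

    run : State → ℕ → A
    run s n = proj₁ (iterate step s n)

    -- run s (suc m) reduces to run (step s) m, so no arithmetic on indices is needed.
    R-path : ∀ s n → R (run s n) (run s (suc n))
    R-path s 0 = R-step s
    R-path s (suc n) = R-path (step s) n

    C-eventually : ∀ {a b c} (rs : Star R a b) (cr : C b c) (pc : P c) →
                   let s = a , b , c , rs , cr , pc in
                   ∃ λ m → C (run s m) (run s (suc m))
    C-eventually ε cr pc = 0 , cr
    C-eventually (r ◅ rs) cr pc with C-eventually rs cr pc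
    ... | m , cm = suc m , cm

    C-infinitely : ∀ s → InfinitelyOften λ m → C (run s m) (run s (suc m))
    C-infinitely (a , b , c , rs , cr , pc) 0 = map₂ (z≤n ,_) (C-eventually rs cr pc)
    C-infinitely s (suc n) with C-infinitely (step s) n
    ... | m , m≥n , cr = suc m , s≤s m≥n , cr

  recurrent-path : ∀ {a} → P a →
    ∃ λ f → (∀ n → R (f n) (f (suc n))) × InfinitelyOften λ m → C (f m) (f (suc m))
  recurrent-path pa = run s , R-path s , C-infinitely s
    where s = _ , progress pa

module InducedSubgraph {Atom : Set} (𝓗 : SimpleProgram Atom) (X : Atom → Set) where

  EdgeIn : Rel Atom 0ℓ
  EdgeIn p q = Edge Atom 𝓗 p q × X q

  CriticalIn : Rel Atom 0ℓ
  CriticalIn p q = Critical Atom 𝓗 p q × X q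

  Reachable : Rel Atom 0ℓ
  Reachable = Star EdgeIn

  Safe : Atom → Set
  Safe a = ∀ {b c} → Reachable a b → ¬ CriticalIn b c

  critical⇒edge : CriticalIn ⇒ EdgeIn
  critical⇒edge ((r , h , t , l) , xq) = (r , h , t , inj₂ l) , xq

  reachable-in-X : ∀ {a b} → X a → Reachable a b → X b
  reachable-in-X xa ε = xa
  reachable-in-X _ ((_ , xb) ◅ rs) = reachable-in-X xb rs

  reachable-closed : ∀ {a p q} → Reachable a p → X q → ¬ Reachable a q → ¬ Edge Atom 𝓗 p q
  reachable-closed rs xq ¬rq e = ¬rq (rs ◅◅ (e , xq) ◅ ε)

  safe⇒critical-free : ∀ {a p q} → Safe a → Reachable a p → X q → ¬ Critical Atom 𝓗 p q
  safe⇒critical-free safe rs xq cr = safe rs (cr , xq)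

  unsafe⇒reaches-critical : DoubleNegationElimination 0ℓ → ∀ {a} → ¬ Safe a →
                            ∃₂ λ b c → Reachable a b × CriticalIn b c × X c
  unsafe⇒reaches-critical dne unsafe =
    dne λ unreached → unsafe λ rs cr → unreached (_ , _ , rs , cr , proj₂ cr)

  nowhere-safe⇒¬tight : DoubleNegationElimination 0ℓ → (∀ {a} → X a → ¬ Safe a) →
                        Σ Atom X → ¬ FLPTight Atom 𝓗
  nowhere-safe⇒¬tight dne unsafe (_ , xa) tight
    with recurrent-path critical⇒edge X (λ xb → unsafe⇒reaches-critical dne (unsafe xb)) xa
  ... | f , edges , criticals = tight (f , proj₁ ∘ edges , map₂ (map₂ proj₁) ∘ criticals)

lemma9 : ExcludedMiddle 0ℓ →
    (Atom : Set) (𝓗 : SimpleProgram Atom) → FLPTight Atom 𝓗 →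
    (X : Atom → Set) → Σ Atom X →
    Σ (Atom → Set) λ K →
      ((a : Atom) → K a → X a) ×
      Σ Atom K ×
      ((p q : Atom) → K p → X q → ¬ K q → ¬ Edge Atom 𝓗 p q) ×
      ((p q : Atom) → K p → X q → ¬ Critical Atom 𝓗 p q)
lemma9 em Atom 𝓗 tight X x with em {∃ λ a → X a × InducedSubgraph.Safe 𝓗 X a}
... | yes (a , xa , safe) =
  Reachable a , (λ _ → reachable-in-X xa) , (a , ε) ,
  (λ _ _ → reachable-closed) , (λ _ _ → safe⇒critical-free safe)
  where open InducedSubgraph 𝓗 X
... | no ∄safe = ⊥-elim (nowhere-safe⇒¬tight (em⇒dne em) (λ xa safe → ∄safe (_ , xa , safe)) x tight)
  where open InducedSubgraph 𝓗 X
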